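{- For all positive integers $k$ and $m$ there exists a constant $c_d(k,m)\leq km$ such that every finite graph $G$ contains a set $T\subseteq V(G)$ with $|T|\leq c_d(k,m)$ for which one of the following holds: (i) $G\setminus T$ is either $k$-connected or complete; (ii) $\mathrm{Conn}(G\setminus T)\leq |G\setminus T|-m$.
   Context: $G\setminus T$ denotes the induced subgraph of $G$ on $V(G)\setminus T$, and $\mathrm{Conn}(H)$ denotes the number of vertices of the largest connected component of a graph $H$. -}

module Defs where

open import Data.Nat using (ℕ; _≤_; _<_; _∸_)
open import Data.Bool using (Bool; true; false)
open import Data.Fin using (Fin)
open import Data.Fin.Subset using (Subset; _∈_; _⊆_; _─_; ∣_∣)
open import Data.Product using (Σ; ∃; _×_)
open import Relation.Binary.PropositionalEquality using (_≡_; _≢_)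

record Graph (n : ℕ) : Set where
  field
    adj     : Fin n → Fin n → Bool
    adj-sym : ∀ u v → adj u v ≡ adj v u
    irrefl  : ∀ v → adj v v ≡ false
open Graph public

module _ {n : ℕ} (G : Graph n) where

  data Walk (S : Subset n) : Fin n → Fin n → Set where
    here : ∀ {v} → v ∈ S → Walk S v v
    step : ∀ {v w u} → v ∈ S → adj G v w ≡ true → Walk S w u → Walk S v u

  Connected : Subset n → Set
  Connected S = ∀ u v → u ∈ S → v ∈ S → Walk S u v

  Complete : Subset n → Set
  Complete S = ∀ u v → u ∈ S → v ∈ S → u ≢ v → adj G u v ≡ true

  KConnected : ℕ → Subset n → Set
  KConnected k S = (k < ∣ S ∣) × (∀ X → X ⊆ S → ∣ X ∣ < k → Connected (S ─ X))

  IsComponent : Subset n → Subset n → Set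
  IsComponent S C = ∃ λ v → v ∈ C × (∀ u → (u ∈ C → (u ∈ S × Walk S v u))
                                         × ((u ∈ S × Walk S v u) → u ∈ C))

  -- Conn(G[S]) ≤ x : every connected component of G[S] has at most x vertices
  -- (Conn of the empty graph is 0).
  ConnAtMost : Subset n → ℕ → Set
  ConnAtMost S x = ∀ C → IsComponent S C → ∣ C ∣ ≤ x

-- Keep a set T of at most (k − 1)s deleted vertices and a partition of G ∖ T into s + 1
-- nonempty classes with no edge between different classes, starting from T = ∅ and s = 0.
-- Let L be a largest class. If the other classes have at least m vertices, every component
-- of G ∖ T lies in one class and so has at most |L| ≤ |G ∖ T| − m vertices. Otherwise, if
-- G[L] is k-connected or complete, deleting the other classes as well costs at most
-- (k − 1)s + m ≤ km vertices. If not, fewer than k vertices separate G[L]; deleting them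
-- splits L and yields s + 2 classes. Since the s classes other than L are nonempty, s < m
-- whenever a split is needed, so at most m splits occur.

module Submission where

open import Data.Bool.Base using (true; false)
open import Data.Bool.Properties using () renaming (_≟_ to _≟ᵇ_)
open import Data.Empty using (⊥-elim)
open import Data.Fin.Base using (Fin; zero)
open import Data.Fin.Properties using (any?) renaming (_≟_ to _≟ᶠ_)
open import Data.Fin.Subset
  using (Subset; _∈_; _∉_; _⊆_; _∪_; _∩_; _─_; _-_; ∁; ⁅_⁆; ∣_∣; ⊥; inside; outside)
open import Data.Fin.Subset.Properties
  using ( _∈?_; _⊆?_; anySubset?; ∣p∣≤n; ∣⊥∣≡0; p⊆q⇒∣p∣≤∣q∣; p⊂q⇒∣p∣<∣q∣
        ; x∈⁅x⁆; x∈⁅y⁆⇒x≡y; x∈p∩q⁺; x∈p∩q⁻; p∩q⊆p; x∈p∪q⁺; x∈p∪q⁻; p⊆p∪q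
        ; x∈∁p⇒x∉p; x∉p⇒x∈∁p; p⊆q⇒∁p⊇∁q; p─q⊆p; x∈p∧x∉q⇒x∈p─q; x∈p∧x≢y⇒x∈p-y; ⊆-trans
        ; x∈p⇒∣p-x∣<∣p∣; ∣⁅x⁆∣≡1; ∉⊥; ∣p─q∣≤∣p∣; ∪-∩-booleanAlgebra)
import Algebra.Lattice.Properties.BooleanAlgebra as BooleanAlgebraProperties
open import Data.Nat.Base
open import Data.Nat.Properties
open import Data.Product using (Σ; ∃; ∃₂; _×_; _,_; proj₁; proj₂)
open import Data.Sum using (_⊎_; inj₁; inj₂)
open import Data.List.Base using (upTo)
open import Data.List.Extrema.Nat using (argmax; argmax-all; f[xs]≤f[argmax])
open import Data.List.Membership.Propositional.Properties using (∈-upTo⁺; ∈-upTo⁻)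
import Data.List.Relation.Unary.All as All
open import Data.Vec.Base using (_∷_; []; tabulate; here; there)
open import Data.Vec.Properties using (lookup∘tabulate; []=⇒lookup; lookup⇒[]=)
open import Level using (0ℓ)
open import Relation.Nullary using (¬_; Dec; yes; no; does; _×-dec_; ¬?; contradiction)
open import Relation.Nullary.Decidable using (dec-true)
open import Function.Base using (_∘′_; case_of_)
open import Relation.Unary using (Pred; Decidable)
open import Relation.Binary.PropositionalEquality using (_≡_; _≢_; refl; sym; trans; cong; subst; module ≡-Reasoning)

open import Defs

private variable
  n : ℕ

⟪_⟫ : {P : Pred (Fin n) 0ℓ} → Decidable P → Subset n
⟪ P? ⟫ = tabulate (λ x → does (P? x))

module _ {P : Pred (Fin n) 0ℓ} (P? : Decidable P) where

  x∈⟪⟫⁺ : ∀ {x} → P x → x ∈ ⟪ P? ⟫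
  x∈⟪⟫⁺ {x} px = lookup⇒[]= x ⟪ P? ⟫ (trans (lookup∘tabulate _ x) (dec-true (P? x) px))

  x∈⟪⟫⁻ : ∀ {x} → x ∈ ⟪ P? ⟫ → P x
  x∈⟪⟫⁻ {x} x∈ with P? x | trans (sym (lookup∘tabulate _ x)) ([]=⇒lookup x∈)
  ... | yes px | _  = px
  ... | no  _  | ()

x∈p─q⇒x∉q : ∀ {p q : Subset n} {x} → x ∈ p ─ q → x ∉ q
x∈p─q⇒x∉q {p = inside  ∷ _} () here
x∈p─q⇒x∉q {p = outside ∷ _} () here
x∈p─q⇒x∉q {p = _ ∷ _} {_ ∷ _} (there x∈p─q) (there x∈q) = x∈p─q⇒x∉q x∈p─q x∈q

∣p∩q∣+∣p─q∣≡∣p∣ : ∀ (p q : Subset n) → ∣ p ∩ q ∣ + ∣ p ─ q ∣ ≡ ∣ p ∣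
∣p∩q∣+∣p─q∣≡∣p∣ []            []            = refl
∣p∩q∣+∣p─q∣≡∣p∣ (inside  ∷ p) (inside  ∷ q) = cong suc (∣p∩q∣+∣p─q∣≡∣p∣ p q)
∣p∩q∣+∣p─q∣≡∣p∣ (inside  ∷ p) (outside ∷ q) =
  trans (+-suc ∣ p ∩ q ∣ ∣ p ─ q ∣) (cong suc (∣p∩q∣+∣p─q∣≡∣p∣ p q))
∣p∩q∣+∣p─q∣≡∣p∣ (outside ∷ p) (inside  ∷ q) = ∣p∩q∣+∣p─q∣≡∣p∣ p q
∣p∩q∣+∣p─q∣≡∣p∣ (outside ∷ p) (outside ∷ q) = ∣p∩q∣+∣p─q∣≡∣p∣ p q

∣p∪q∣≤∣p∣+∣q∣ : ∀ (p q : Subset n) → ∣ p ∪ q ∣ ≤ ∣ p ∣ + ∣ q ∣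
∣p∪q∣≤∣p∣+∣q∣ []            []            = z≤n
∣p∪q∣≤∣p∣+∣q∣ (inside  ∷ p) (inside  ∷ q) =
  s≤s (≤-trans (∣p∪q∣≤∣p∣+∣q∣ p q) (+-monoʳ-≤ ∣ p ∣ (n≤1+n ∣ q ∣)))
∣p∪q∣≤∣p∣+∣q∣ (inside  ∷ p) (outside ∷ q) = s≤s (∣p∪q∣≤∣p∣+∣q∣ p q)
∣p∪q∣≤∣p∣+∣q∣ (outside ∷ p) (inside  ∷ q) =
  ≤-trans (s≤s (∣p∪q∣≤∣p∣+∣q∣ p q)) (≤-reflexive (sym (+-suc ∣ p ∣ ∣ q ∣)))
∣p∪q∣≤∣p∣+∣q∣ (outside ∷ p) (outside ∷ q) = ∣p∪q∣≤∣p∣+∣q∣ p q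

p⊆q∧∣q∣≤∣p∣⇒q⊆p : ∀ {p q : Subset n} → p ⊆ q → ∣ q ∣ ≤ ∣ p ∣ → q ⊆ p
p⊆q∧∣q∣≤∣p∣⇒q⊆p {p = p} p⊆q ∣q∣≤∣p∣ {x} x∈q with x ∈? p
... | yes x∈p = x∈p
... | no  x∉p = ⊥-elim (<⇒≱ (p⊂q⇒∣p∣<∣q∣ (p⊆q , x , x∈q , x∉p)) ∣q∣≤∣p∣)

∁-involutive : ∀ (p : Subset n) → ∁ (∁ p) ≡ p
∁-involutive {n} = BooleanAlgebraProperties.¬-involutive (∪-∩-booleanAlgebra n)

-- Restricting p to the values below t loses the witness of t but keeps those of all smaller values.
≤∣p∣-if-hits-below : (f : Fin n → ℕ) (t : ℕ) (p : Subset n) →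
                     (∀ {i} → i < t → ∃ λ x → x ∈ p × f x ≡ i) → t ≤ ∣ p ∣
≤∣p∣-if-hits-below f zero    p hits = z≤n
≤∣p∣-if-hits-below f (suc t) p hits with hits (n<1+n t)
... | x , x∈p , fx≡t = <-≤-trans (s≤s t≤∣p∩B∣) (p⊂q⇒∣p∣<∣q∣ (p∩q⊆p p B , x , x∈p , x∉p∩B))
  where
  below? : Decidable (λ y → f y < t)
  below? y = f y <? t
  B : Subset _
  B = ⟪ below? ⟫
  t≤∣p∩B∣ : t ≤ ∣ p ∩ B ∣
  t≤∣p∩B∣ = ≤∣p∣-if-hits-below f t (p ∩ B) λ {i} i<t →
    let (y , y∈p , fy≡i) = hits (m<n⇒m<1+n i<t)
    in y , x∈p∩q⁺ (y∈p , x∈⟪⟫⁺ below? (subst (_< t) (sym fy≡i) i<t)) , fy≡i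
  x∉p∩B : x ∉ p ∩ B
  x∉p∩B x∈p∩B = <-irrefl fx≡t (x∈⟪⟫⁻ below? (proj₂ (x∈p∩q⁻ p B x∈p∩B)))

module Stabilise (F : Subset n → Subset n) (⊆F : ∀ R → R ⊆ F R) where

  stabilise : ℕ → Subset n → Subset n
  stabilise zero    R = R
  stabilise (suc f) R with ∣ F R ∣ ≤? ∣ R ∣
  ... | yes _ = R
  ... | no  _ = stabilise f (F R)

  ⊆-stabilise : ∀ f R → R ⊆ stabilise f R
  ⊆-stabilise zero    R x∈R = x∈R
  ⊆-stabilise (suc f) R x∈R with ∣ F R ∣ ≤? ∣ R ∣
  ... | yes _ = x∈R
  ... | no  _ = ⊆-stabilise f (F R) (⊆F R x∈R)

  stabilise-preserves : (P : Subset n → Set) → (∀ {R} → P R → P (F R)) →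
                        ∀ f {R} → P R → P (stabilise f R)
  stabilise-preserves P pres zero    pR = pR
  stabilise-preserves P pres (suc f) {R} pR with ∣ F R ∣ ≤? ∣ R ∣
  ... | yes _ = pR
  ... | no  _ = stabilise-preserves P pres f (pres pR)

  -- Every non-final round adds a vertex, so with this much fuel the last round adds none.
  stabilise-closed : ∀ f R → n < f + ∣ R ∣ → F (stabilise f R) ⊆ stabilise f R
  stabilise-closed zero    R n<∣R∣ = ⊥-elim (<⇒≱ n<∣R∣ (∣p∣≤n R))
  stabilise-closed (suc f) R n<f+∣R∣ with ∣ F R ∣ ≤? ∣ R ∣
  ... | yes ∣FR∣≤∣R∣ = p⊆q∧∣q∣≤∣p∣⇒q⊆p (⊆F R) ∣FR∣≤∣R∣
  ... | no  ∣FR∣≰∣R∣ = stabilise-closed f (F R) (begin-strict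
    n                <⟨ n<f+∣R∣ ⟩
    suc f + ∣ R ∣    ≡⟨ +-suc f ∣ R ∣ ⟨
    f + suc ∣ R ∣    ≤⟨ +-monoʳ-≤ f (≰⇒> ∣FR∣≰∣R∣) ⟩
    f + ∣ F R ∣      ∎)
    where open ≤-Reasoning

module Walks (G : Graph n) where

  walk-source : ∀ {S u v} → Walk G S u v → u ∈ S
  walk-source (here u∈S)     = u∈S
  walk-source (step u∈S _ _) = u∈S

  walk-snoc : ∀ {S u v w} → Walk G S u v → adj G v w ≡ true → w ∈ S → Walk G S u w
  walk-snoc (here v∈S)          vw w∈S = step v∈S vw (here w∈S)
  walk-snoc (step u∈S uw walk) vw w∈S = step u∈S uw (walk-snoc walk vw w∈S)

  neighbour? : ∀ S R → Decidable (λ x → x ∈ S × ∃ λ w → w ∈ R × adj G w x ≡ true)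
  neighbour? S R x = (x ∈? S) ×-dec any? (λ w → (w ∈? R) ×-dec (adj G w x ≟ᵇ true))

  grow : Subset n → Subset n → Subset n
  grow S R = R ∪ ⟪ neighbour? S R ⟫

  module Reach (S : Subset n) (u : Fin n) where
    open Stabilise (grow S) (λ R → p⊆p∪q _)

    reach : Subset n
    reach = stabilise (suc n) (S ∩ ⁅ u ⁆)

    WalksFromU : Subset n → Set
    WalksFromU R = ∀ {x} → x ∈ R → x ∈ S × Walk G S u x

    grow-walks : ∀ {R} → WalksFromU R → WalksFromU (grow S R)
    grow-walks {R} walks x∈ with x∈p∪q⁻ R _ x∈
    ... | inj₁ x∈R = walks x∈R
    ... | inj₂ x∈N with x∈⟪⟫⁻ (neighbour? S R) x∈N
    ...   | x∈S , w , w∈R , wx = x∈S , walk-snoc (proj₂ (walks w∈R)) wx x∈S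

    start-walks : WalksFromU (S ∩ ⁅ u ⁆)
    start-walks x∈ with x∈p∩q⁻ S ⁅ u ⁆ x∈
    ... | x∈S , x∈⁅u⁆ with x∈⁅y⁆⇒x≡y u x∈⁅u⁆
    ...   | refl = x∈S , here x∈S

    reach-sound : WalksFromU reach
    reach-sound = stabilise-preserves WalksFromU grow-walks (suc n) start-walks

    reach-start : u ∈ S → u ∈ reach
    reach-start u∈S = ⊆-stabilise (suc n) _ (x∈p∩q⁺ (u∈S , x∈⁅x⁆ u))

    reach-closed : ∀ {w x} → w ∈ reach → x ∈ S → adj G w x ≡ true → x ∈ reach
    reach-closed w∈ x∈S wx = stabilise-closed (suc n) (S ∩ ⁅ u ⁆) (s≤s (m≤m+n n _))
      (x∈p∪q⁺ {p = reach} (inj₂ (x∈⟪⟫⁺ (neighbour? S reach) (x∈S , _ , w∈ , wx))))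

    reach-complete : ∀ {v x} → Walk G S v x → v ∈ reach → x ∈ reach
    reach-complete (here _)         v∈ = v∈
    reach-complete (step _ vw walk) v∈ = reach-complete walk (reach-closed v∈ (walk-source walk) vw)

  walk? : ∀ S u v → Dec (Walk G S u v)
  walk? S u v with v ∈? Reach.reach S u
  ... | yes v∈ = yes (proj₂ (Reach.reach-sound S u v∈))
  ... | no  v∉ = no λ walk →
    v∉ (Reach.reach-complete S u walk (Reach.reach-start S u (walk-source walk)))

module Separations (G : Graph n) where
  open Walks G

  Separates : ℕ → Subset n → Subset n → Set
  Separates k S X = X ⊆ S × ∣ X ∣ < k ×
                    ∃₂ λ u v → u ∈ S ─ X × v ∈ S ─ X × ¬ Walk G (S ─ X) u v

  separates? : ∀ k S → Decidable (Separates k S)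
  separates? k S X = (X ⊆? S) ×-dec (∣ X ∣ <? k) ×-dec any? λ u → any? λ v →
    (u ∈? S ─ X) ×-dec (v ∈? S ─ X) ×-dec ¬? (walk? (S ─ X) u v)

  NonAdjacentPair : Subset n → Fin n → Fin n → Set
  NonAdjacentPair S u v = u ∈ S × v ∈ S × u ≢ v × adj G u v ≡ false

  complete⊎nonAdjacentPair : ∀ S → Complete G S ⊎ ∃₂ (NonAdjacentPair S)
  complete⊎nonAdjacentPair S with any? (λ u → any? λ v →
    (u ∈? S) ×-dec (v ∈? S) ×-dec ¬? (u ≟ᶠ v) ×-dec (adj G u v ≟ᵇ false))
  ... | yes pair   = inj₂ pair
  ... | no  ¬pair = inj₁ complete
    where
    complete : Complete G S
    complete u v u∈S v∈S u≢v with adj G u v in uv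
    ... | true  = refl
    ... | false = ⊥-elim (¬pair (u , v , u∈S , v∈S , u≢v , uv))

  nonAdjacentPair⇒separates : ∀ {k S u v} → ∣ S ∣ ≤ k → NonAdjacentPair S u v → Separates k S (S - u - v)
  nonAdjacentPair⇒separates {S = S} {u} {v} ∣S∣≤k (u∈S , v∈S , u≢v , uv) =
    X⊆S , <-≤-trans ∣X∣<∣S∣ ∣S∣≤k , u , v , u∈S─X , v∈S─X , no-walk
    where
    X = S - u - v
    X⊆S : X ⊆ S
    X⊆S = ⊆-trans (p─q⊆p (S - u) ⁅ v ⁆) (p─q⊆p S ⁅ u ⁆)
    ∣X∣<∣S∣ : ∣ X ∣ < ∣ S ∣
    ∣X∣<∣S∣ = ≤-<-trans (∣p─q∣≤∣p∣ (S - u) ⁅ v ⁆) (x∈p⇒∣p-x∣<∣p∣ u∈S)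
    u∈S─X : u ∈ S ─ X
    u∈S─X = x∈p∧x∉q⇒x∈p─q u∈S λ u∈X →
      x∈p─q⇒x∉q (p─q⊆p (S - u) ⁅ v ⁆ u∈X) (x∈⁅x⁆ u)
    v∈S─X : v ∈ S ─ X
    v∈S─X = x∈p∧x∉q⇒x∈p─q v∈S λ v∈X → x∈p─q⇒x∉q v∈X (x∈⁅x⁆ v)
    only-u-v : ∀ {w} → w ∈ S ─ X → w ≡ u ⊎ w ≡ v
    only-u-v {w} w∈S─X with w ≟ᶠ u | w ≟ᶠ v
    ... | yes w≡u | _        = inj₁ w≡u
    ... | no  _   | yes w≡v  = inj₂ w≡v
    ... | no  w≢u | no  w≢v  = ⊥-elim (x∈p─q⇒x∉q w∈S─X
          (x∈p∧x≢y⇒x∈p-y (x∈p∧x≢y⇒x∈p-y (p─q⊆p S X w∈S─X) w≢u) w≢v))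
    no-walk : ¬ Walk G (S ─ X) u v
    no-walk (here _) = u≢v refl
    no-walk (step _ uw walk) with only-u-v (walk-source walk)
    ... | inj₁ refl = contradiction (trans (sym (irrefl G u)) uw) λ ()
    ... | inj₂ refl = contradiction (trans (sym uv) uw) λ ()

  kConnected⊎complete⊎separated : ∀ k S → (KConnected G k S ⊎ Complete G S) ⊎ ∃ (Separates k S)
  kConnected⊎complete⊎separated k S with anySubset? (separates? k S)
  ... | yes separation = inj₂ separation
  ... | no  ¬separation with k <? ∣ S ∣
  ...   | yes k<∣S∣ = inj₁ (inj₁ (k<∣S∣ , connected))
    where
    connected : ∀ X → X ⊆ S → ∣ X ∣ < k → Connected G (S ─ X)
    connected X X⊆S ∣X∣<k u v u∈ v∈ with walk? (S ─ X) u v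
    ... | yes walk = walk
    ... | no  ¬walk = ⊥-elim (¬separation (X , X⊆S , ∣X∣<k , u , v , u∈ , v∈ , ¬walk))
  ...   | no  k≮∣S∣ with complete⊎nonAdjacentPair S
  ...     | inj₁ complete          = inj₁ (inj₂ complete)
  ...     | inj₂ (u , v , uv-pair) = inj₂ (_ , nonAdjacentPair⇒separates (≮⇒≥ k≮∣S∣) uv-pair)

module Splittings (G : Graph n) (k′ : ℕ) where
  open Walks G
  open Separations G

  record Splitting (s : ℕ) : Set where
    field
      removed         : Subset n
      class           : Fin n → ℕ
      class≤          : ∀ {x} → x ∈ ∁ removed → class x ≤ s
      class-inhabited : ∀ {i} → i ≤ s → ∃ λ x → x ∈ ∁ removed × class x ≡ i
      edge⇒same-class : ∀ {x y} → x ∈ ∁ removed → y ∈ ∁ removed → adj G x y ≡ true →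
                        class x ≡ class y
      ∣removed∣≤      : ∣ removed ∣ ≤ k′ * s

  open Splitting

  initialSplitting : Fin n → Splitting 0
  initialSplitting x = record
    { removed         = ⊥
    ; class           = λ _ → 0
    ; class≤          = λ _ → z≤n
    ; class-inhabited = λ { z≤n → x , x∉p⇒x∈∁p ∉⊥ , refl }
    ; edge⇒same-class = λ _ _ _ → refl
    ; ∣removed∣≤      = ≤-reflexive (trans (∣⊥∣≡0 n) (sym (*-zeroʳ k′)))
    }

  module _ {s} (σ : Splitting s) where

    inClass? : (a : ℕ) → Decidable (λ x → class σ x ≡ a)
    inClass? a x = class σ x ≟ a

    block rest : ℕ → Subset n
    block a = ∁ (removed σ) ∩ ⟪ inClass? a ⟫
    rest  a = ∁ (removed σ) ─ ⟪ inClass? a ⟫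

    ∈block⁺ : ∀ {a x} → x ∈ ∁ (removed σ) → class σ x ≡ a → x ∈ block a
    ∈block⁺ {a} x∈ x-a = x∈p∩q⁺ (x∈ , x∈⟪⟫⁺ (inClass? a) x-a)

    ∈block⁻ : ∀ {a x} → x ∈ block a → x ∈ ∁ (removed σ) × class σ x ≡ a
    ∈block⁻ {a} x∈ with x∈p∩q⁻ (∁ (removed σ)) _ x∈
    ... | x∈∁ , x∈⟪⟫ = x∈∁ , x∈⟪⟫⁻ (inClass? a) x∈⟪⟫

    ∈rest⁺ : ∀ {a x} → x ∈ ∁ (removed σ) → class σ x ≢ a → x ∈ rest a
    ∈rest⁺ {a} x∈ x≢a = x∈p∧x∉q⇒x∈p─q x∈ (x≢a ∘′ x∈⟪⟫⁻ (inClass? a))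

    ∣block∣+∣rest∣≡∣∁removed∣ : ∀ a → ∣ block a ∣ + ∣ rest a ∣ ≡ ∣ ∁ (removed σ) ∣
    ∣block∣+∣rest∣≡∣∁removed∣ a = ∣p∩q∣+∣p─q∣≡∣p∣ (∁ (removed σ)) ⟪ inClass? a ⟫

    walk⇒same-class : ∀ {x y} → Walk G (∁ (removed σ)) x y → class σ x ≡ class σ y
    walk⇒same-class (here _)           = refl
    walk⇒same-class (step x∈ xz walk) =
      trans (edge⇒same-class σ x∈ (walk-source walk) xz) (walk⇒same-class walk)

    component⊆block : ∀ {C} → IsComponent G (∁ (removed σ)) C → ∃ λ a → a ≤ s × C ⊆ block a
    component⊆block (v , v∈C , C-reach) = class σ v , class≤ σ v∈∁ , C⊆block
      where
      v∈∁ = proj₁ (proj₁ (C-reach v) v∈C)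
      C⊆block : _ ⊆ block (class σ v)
      C⊆block {x} x∈C = let (x∈∁ , walk) = proj₁ (C-reach x) x∈C
                        in ∈block⁺ x∈∁ (sym (walk⇒same-class walk))

    largest : ℕ
    largest = argmax (λ i → ∣ block i ∣) 0 (upTo (suc s))

    largest≤s : largest ≤ s
    largest≤s = argmax-all (λ i → ∣ block i ∣) z≤n (All.tabulate λ i∈ → ≤-pred (∈-upTo⁻ i∈))

    ∣block∣≤∣block-largest∣ : ∀ {i} → i ≤ s → ∣ block i ∣ ≤ ∣ block largest ∣
    ∣block∣≤∣block-largest∣ i≤s =
      All.lookup (f[xs]≤f[argmax] {f = λ i → ∣ block i ∣} 0 (upTo (suc s))) (∈-upTo⁺ (s≤s i≤s))

    -- The other s classes are nonempty and lie in rest a: add one vertex of class a and count.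
    s≤∣rest∣ : ∀ {a} → a ≤ s → s ≤ ∣ rest a ∣
    s≤∣rest∣ {a} a≤s with class-inhabited σ a≤s
    ... | xₐ , xₐ∈ , xₐ-a = ≤-pred (begin
      suc s                       ≤⟨ ≤∣p∣-if-hits-below (class σ) (suc s) P hits ⟩
      ∣ P ∣                       ≤⟨ ∣p∪q∣≤∣p∣+∣q∣ (rest a) ⁅ xₐ ⁆ ⟩
      ∣ rest a ∣ + ∣ ⁅ xₐ ⁆ ∣     ≡⟨ cong (∣ rest a ∣ +_) (∣⁅x⁆∣≡1 xₐ) ⟩
      ∣ rest a ∣ + 1              ≡⟨ +-comm ∣ rest a ∣ 1 ⟩
      suc ∣ rest a ∣              ∎)
      where
      open ≤-Reasoning
      P = rest a ∪ ⁅ xₐ ⁆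
      hits : ∀ {i} → i < suc s → ∃ λ x → x ∈ P × class σ x ≡ i
      hits {i} i<1+s with i ≟ a | class-inhabited σ (≤-pred i<1+s)
      ... | yes refl | _              = xₐ , x∈p∪q⁺ (inj₂ (x∈⁅x⁆ xₐ)) , xₐ-a
      ... | no  i≢a  | x , x∈ , x-i = x , x∈p∪q⁺ (inj₁ (∈rest⁺ x∈ (i≢a ∘′ trans (sym x-i)))) , x-i

    ∣block-largest∣≤ : ∀ {m} → m ≤ ∣ rest largest ∣ → ∣ block largest ∣ ≤ ∣ ∁ (removed σ) ∣ ∸ m
    ∣block-largest∣≤ {m} m≤∣rest∣ = begin
      ∣ block largest ∣                                       ≡⟨ m+n∸n≡m _ ∣ rest largest ∣ ⟨
      ∣ block largest ∣ + ∣ rest largest ∣ ∸ ∣ rest largest ∣ ≡⟨ cong (_∸ ∣ rest largest ∣) ∣block∣+∣rest∣ ⟩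
      ∣ ∁ (removed σ) ∣ ∸ ∣ rest largest ∣                    ≤⟨ ∸-monoʳ-≤ ∣ ∁ (removed σ) ∣ m≤∣rest∣ ⟩
      ∣ ∁ (removed σ) ∣ ∸ m                                   ∎
      where
      open ≤-Reasoning
      ∣block∣+∣rest∣ = ∣block∣+∣rest∣≡∣∁removed∣ largest

    components-small : ∀ {m} → m ≤ ∣ rest largest ∣ →
                       m ≤ ∣ ∁ (removed σ) ∣ × ConnAtMost G (∁ (removed σ)) (∣ ∁ (removed σ) ∣ ∸ m)
    components-small m≤∣rest∣ = m≤∣∁removed∣ , C-small
      where
      m≤∣∁removed∣ = ≤-trans m≤∣rest∣ (≤-trans (m≤n+m _ _) (≤-reflexive (∣block∣+∣rest∣≡∣∁removed∣ largest)))
      C-small : ConnAtMost G (∁ (removed σ)) _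
      C-small C C-comp with component⊆block C-comp
      ... | a , a≤s , C⊆block = ≤-trans (p⊆q⇒∣p∣≤∣q∣ C⊆block)
                                  (≤-trans (∣block∣≤∣block-largest∣ a≤s) (∣block-largest∣≤ m≤∣rest∣))

    ∁block⊆removed∪rest : ∀ a → ∁ (block a) ⊆ removed σ ∪ rest a
    ∁block⊆removed∪rest a {x} x∈∁block with x ∈? removed σ
    ... | yes x∈removed = x∈p∪q⁺ (inj₁ x∈removed)
    ... | no  x∉removed = x∈p∪q⁺ (inj₂ (∈rest⁺ x∈∁removed λ x-a →
                            x∈∁p⇒x∉p x∈∁block (∈block⁺ x∈∁removed x-a)))
      where x∈∁removed = x∉p⇒x∈∁p x∉removed

    ∣∁block∣≤ : ∀ a → ∣ ∁ (block a) ∣ ≤ ∣ removed σ ∣ + ∣ rest a ∣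
    ∣∁block∣≤ a = ≤-trans (p⊆q⇒∣p∣≤∣q∣ (∁block⊆removed∪rest a)) (∣p∪q∣≤∣p∣+∣q∣ (removed σ) (rest a))

  -- The separator joins the removed set; the part of the split class reachable from u becomes class s + 1.
  module Refinement {s} (σ : Splitting s) (a : ℕ) {X u v} (X⊆L : X ⊆ block σ a)
                    (∣X∣<k : ∣ X ∣ < suc k′) (u∈L─X : u ∈ block σ a ─ X) (v∈L─X : v ∈ block σ a ─ X)
                    (u↛v : ¬ Walk G (block σ a ─ X) u v) where
    open Reach (block σ a ─ X) u

    removed′ : Subset n
    removed′ = removed σ ∪ X

    class′ : Fin n → ℕ
    class′ x with x ∈? reach
    ... | yes _ = suc s
    ... | no  _ = class σ x

    class′-reach : ∀ {x} → x ∈ reach → class′ x ≡ suc s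
    class′-reach {x} x∈ with x ∈? reach
    ... | yes _  = refl
    ... | no  x∉ = contradiction x∈ x∉

    class′-¬reach : ∀ {x} → x ∉ reach → class′ x ≡ class σ x
    class′-¬reach {x} x∉ with x ∈? reach
    ... | yes x∈ = contradiction x∈ x∉
    ... | no  _  = refl

    ∁removed′⊆∁removed : ∁ removed′ ⊆ ∁ (removed σ)
    ∁removed′⊆∁removed = p⊆q⇒∁p⊇∁q (p⊆p∪q X)

    L─X⊆∁removed′ : block σ a ─ X ⊆ ∁ removed′
    L─X⊆∁removed′ x∈L─X = x∉p⇒x∈∁p λ x∈removed′ → case x∈p∪q⁻ (removed σ) X x∈removed′ of λ where
      (inj₁ x∈removed) → x∈∁p⇒x∉p (proj₁ (∈block⁻ σ (p─q⊆p _ X x∈L─X))) x∈removed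
      (inj₂ x∈X)       → x∈p─q⇒x∉q x∈L─X x∈X

    reach-closed-in-∁removed′ : ∀ {x y} → x ∈ reach → y ∈ ∁ removed′ → adj G x y ≡ true → y ∈ reach
    reach-closed-in-∁removed′ x∈ y∈ xy = reach-closed x∈ y∈L─X xy
      where
      x∈L = p─q⊆p _ X (proj₁ (reach-sound x∈))
      y∈∁removed = ∁removed′⊆∁removed y∈
      y-a = trans (sym (edge⇒same-class σ (proj₁ (∈block⁻ σ x∈L)) y∈∁removed xy)) (proj₂ (∈block⁻ σ x∈L))
      y∈L─X = x∈p∧x∉q⇒x∈p─q (∈block⁺ σ y∈∁removed y-a) λ y∈X → x∈∁p⇒x∉p y∈ (x∈p∪q⁺ (inj₂ y∈X))

    class′≤ : ∀ {x} → x ∈ ∁ removed′ → class′ x ≤ suc s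
    class′≤ {x} x∈ with x ∈? reach
    ... | yes _ = ≤-refl
    ... | no  _ = m≤n⇒m≤1+n (class≤ σ (∁removed′⊆∁removed x∈))

    edge⇒same-class′ : ∀ {x y} → x ∈ ∁ removed′ → y ∈ ∁ removed′ → adj G x y ≡ true → class′ x ≡ class′ y
    edge⇒same-class′ {x} {y} x∈ y∈ xy = by-reach (x ∈? reach) (y ∈? reach)
      where
      by-reach : Dec (x ∈ reach) → Dec (y ∈ reach) → class′ x ≡ class′ y
      by-reach (yes x∈R) (yes y∈R) = trans (class′-reach x∈R) (sym (class′-reach y∈R))
      by-reach (yes x∈R) (no  y∉R) = contradiction (reach-closed-in-∁removed′ x∈R y∈ xy) y∉R
      by-reach (no  x∉R) (yes y∈R) =
        contradiction (reach-closed-in-∁removed′ y∈R x∈ (trans (adj-sym G y x) xy)) x∉R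
      by-reach (no  x∉R) (no  y∉R) = begin
        class′ x  ≡⟨ class′-¬reach x∉R ⟩
        class σ x ≡⟨ edge⇒same-class σ (∁removed′⊆∁removed x∈) (∁removed′⊆∁removed y∈) xy ⟩
        class σ y ≡⟨ class′-¬reach y∉R ⟨
        class′ y  ∎
        where open ≡-Reasoning

    class′-inhabited : ∀ {i} → i ≤ suc s → ∃ λ x → x ∈ ∁ removed′ × class′ x ≡ i
    class′-inhabited {i} i≤1+s with i ≟ suc s | i ≟ a
    ... | yes refl | _        = u , L─X⊆∁removed′ u∈L─X , class′-reach (reach-start u∈L─X)
    ... | no  _    | yes refl = v , L─X⊆∁removed′ v∈L─X ,
      trans (class′-¬reach λ v∈R → u↛v (proj₂ (reach-sound v∈R))) (proj₂ (∈block⁻ σ (p─q⊆p _ X v∈L─X)))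
    ... | no  i≢1+s | no i≢a with class-inhabited σ (≤-pred (≤∧≢⇒< i≤1+s i≢1+s))
    ...   | x , x∈ , x-i = x , x∉p⇒x∈∁p x∉removed′ , trans (class′-¬reach x∉R) x-i
      where
      x∉L : x ∉ block σ a
      x∉L x∈L = i≢a (trans (sym x-i) (proj₂ (∈block⁻ σ x∈L)))
      x∉R : x ∉ reach
      x∉R x∈R = x∉L (p─q⊆p _ X (proj₁ (reach-sound x∈R)))
      x∉removed′ : x ∉ removed′
      x∉removed′ x∈removed′ with x∈p∪q⁻ (removed σ) X x∈removed′
      ... | inj₁ x∈removed = x∈∁p⇒x∉p x∈ x∈removed
      ... | inj₂ x∈X       = x∉L (X⊆L x∈X)

    ∣removed′∣≤ : ∣ removed′ ∣ ≤ k′ * suc s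
    ∣removed′∣≤ = begin
      ∣ removed σ ∪ X ∣        ≤⟨ ∣p∪q∣≤∣p∣+∣q∣ (removed σ) X ⟩
      ∣ removed σ ∣ + ∣ X ∣    ≤⟨ +-mono-≤ (∣removed∣≤ σ) (≤-pred ∣X∣<k) ⟩
      k′ * s + k′              ≡⟨ +-comm (k′ * s) k′ ⟩
      k′ + k′ * s              ≡⟨ *-suc k′ s ⟨
      k′ * suc s               ∎
      where open ≤-Reasoning

    refined : Splitting (suc s)
    refined = record
      { removed         = removed′
      ; class           = class′
      ; class≤          = class′≤
      ; class-inhabited = class′-inhabited
      ; edge⇒same-class = edge⇒same-class′
      ; ∣removed∣≤      = ∣removed′∣≤
      }

  refine : ∀ {s} (σ : Splitting s) {a} → ∃ (Separates (suc k′) (block σ a)) → Splitting (suc s)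
  refine σ {a} (X , X⊆L , ∣X∣<k , u , v , u∈ , v∈ , u↛v) =
    Refinement.refined σ a X⊆L ∣X∣<k u∈ v∈ u↛v

module _ (G : Graph n) (k′ m : ℕ) where
  open Separations G
  open Splittings G k′

  Solution : Set
  Solution = Σ (Subset n) λ T → ∣ T ∣ ≤ suc k′ * m ×
               ((KConnected G (suc k′) (∁ T) ⊎ Complete G (∁ T))
                ⊎ (m ≤ ∣ ∁ T ∣ × ConnAtMost G (∁ T) (∣ ∁ T ∣ ∸ m)))

  removed-small : ∀ {s} → s ≤ m → (σ : Splitting s) → ∣ Splitting.removed σ ∣ ≤ k′ * m
  removed-small s≤m σ = ≤-trans (Splitting.∣removed∣≤ σ) (*-monoʳ-≤ k′ s≤m)

  components-solution : ∀ {s} → s ≤ m → (σ : Splitting s) → m ≤ ∣ rest σ (largest σ) ∣ → Solution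
  components-solution s≤m σ m≤∣rest∣ =
    Splitting.removed σ , ≤-trans (removed-small s≤m σ) (m≤n+m (k′ * m) m) ,
    inj₂ (components-small σ m≤∣rest∣)

  block-solution : ∀ {s} → s ≤ m → (σ : Splitting s) → ∀ {a} → ∣ rest σ a ∣ ≤ m →
                   KConnected G (suc k′) (block σ a) ⊎ Complete G (block σ a) → Solution
  block-solution s≤m σ {a} ∣rest∣≤m good = ∁ (block σ a) , ∣∁block∣≤k*m , inj₁ good′
    where
    ∣∁block∣≤k*m = begin
      ∣ ∁ (block σ a) ∣                         ≤⟨ ∣∁block∣≤ σ a ⟩
      ∣ Splitting.removed σ ∣ + ∣ rest σ a ∣    ≤⟨ +-mono-≤ (removed-small s≤m σ) ∣rest∣≤m ⟩
      k′ * m + m                                ≡⟨ +-comm (k′ * m) m ⟩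
      suc k′ * m                                ∎
      where open ≤-Reasoning
    good′ = subst (λ S → KConnected G (suc k′) S ⊎ Complete G S) (sym (∁-involutive (block σ a))) good

  -- Each refinement adds a class, and s ≤ ∣ rest ∣ < m whenever a refinement is needed.
  solve : ∀ d {s} → s + d ≡ m → Splitting s → Solution
  solve d {s} s+d≡m σ = by-cases (m ≤? ∣ rest σ L ∣) (kConnected⊎complete⊎separated (suc k′) (block σ L))
    where
    L = largest σ

    s≤m : s ≤ m
    s≤m = subst (s ≤_) s+d≡m (m≤m+n s d)

    s<m : ¬ m ≤ ∣ rest σ L ∣ → s < m
    s<m m≰∣rest∣ = ≤-<-trans (s≤∣rest∣ σ (largest≤s σ)) (≰⇒> m≰∣rest∣)

    continue : ∀ d → s + d ≡ m → s < m → Splitting (suc s) → Solution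
    continue zero    s+0≡m  s<m _ = contradiction (trans (sym (+-identityʳ s)) s+0≡m) (<⇒≢ s<m)
    continue (suc d) s+1+d≡m _  τ = solve d (trans (sym (+-suc s d)) s+1+d≡m) τ

    by-cases : Dec (m ≤ ∣ rest σ L ∣) →
               (KConnected G (suc k′) (block σ L) ⊎ Complete G (block σ L)) ⊎ ∃ (Separates (suc k′) (block σ L)) →
               Solution
    by-cases (yes m≤∣rest∣) _                 = components-solution s≤m σ m≤∣rest∣
    by-cases (no  m≰∣rest∣) (inj₁ good)       = block-solution s≤m σ (<⇒≤ (≰⇒> m≰∣rest∣)) good
    by-cases (no  m≰∣rest∣) (inj₂ separation) = continue d s+d≡m (s<m m≰∣rest∣) (refine σ separation)

solution : ∀ {n} (G : Graph n) k′ m → Solution G k′ m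
solution {zero}  G k′ m = ⊥ , z≤n , inj₁ (inj₂ λ ())
solution {suc _} G k′ m = solve G k′ m m refl (Splittings.initialSplitting G k′ zero)

lemma5p5 : (k m : ℕ) → 1 ≤ k → 1 ≤ m →
    Σ ℕ λ c → c ≤ k * m ×
      ((n : ℕ) (G : Graph n) → Σ (Subset n) λ T → ∣ T ∣ ≤ c ×
        ((KConnected G k (∁ T) ⊎ Complete G (∁ T))
         ⊎ (m ≤ ∣ ∁ T ∣ × ConnAtMost G (∁ T) (∣ ∁ T ∣ ∸ m))))
-- 1 ≤ k rules out k = 0.
lemma5p5 (suc k′) m _ _ = suc k′ * m , ≤-refl , λ n G → solution G k′ m
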